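{- Let $m,p$ be natural numbers with $0<m\le p/2$ and $p\ge 3$. Then there exists a digraph $D$ of order $p$ with $\mathsf{d}_s^-(D)=m$.
   Context: Digraphs are finite, loopless, without parallel arcs. A digraph is strong if for every ordered pair $u,v$ there is a directed $uv$-walk. $S\subseteq V(D)$ is in-dominating if every vertex not in $S$ has an out-neighbor in $S$; strong in-dominating if moreover $D\langle S\rangle$ is strong. $\mathsf{d}_s^-(D)$ (defined for strong $D$) is the maximum number of classes of a partition of $V(D)$ into strong in-dominating sets. -}

module Defs where

open import Data.Nat using (ℕ; _≤_)
open import Data.Fin using (Fin)
open import Data.Bool using (Bool; true; false)
open import Data.Unit using (⊤)
open import Data.Product using (Σ; ∃; _×_)
open import Relation.Nullary using (¬_)
open import Relation.Binary.PropositionalEquality using (_≡_)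

-- A digraph of order p: vertex set Fin p, arc relation given by a Boolean
-- adjacency function (so no parallel arcs), loopless.
record Digraph (p : ℕ) : Set where
  field
    arc      : Fin p → Fin p → Bool
    loopless : ∀ v → arc v v ≡ false
open Digraph public

Arc : ∀ {p} → Digraph p → Fin p → Fin p → Set
Arc D u v = arc D u v ≡ true

-- Directed walks from u to v all of whose vertices lie in S
-- (i.e. walks in the induced subdigraph D⟨S⟩).
data WalkIn {p : ℕ} (D : Digraph p) (S : Fin p → Set) : Fin p → Fin p → Set where
  here : ∀ {u} → S u → WalkIn D S u u
  step : ∀ {u w v} → S u → Arc D u w → WalkIn D S w v → WalkIn D S u v

Strong : ∀ {p} → Digraph p → Set
Strong D = ∀ u v → WalkIn D (λ _ → ⊤) u v

InducedStrong : ∀ {p} → Digraph p → (Fin p → Set) → Set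
InducedStrong D S = ∀ u v → S u → S v → WalkIn D S u v

InDominating : ∀ {p} → Digraph p → (Fin p → Set) → Set
InDominating D S = ∀ v → ¬ S v → ∃ λ w → S w × Arc D v w

StrongInDominating : ∀ {p} → Digraph p → (Fin p → Set) → Set
StrongInDominating D S = InDominating D S × InducedStrong D S

HasSIDPartition : ∀ {p} → Digraph p → ℕ → Set
HasSIDPartition {p} D k =
  Σ (Fin p → Fin k) λ c →
    ∀ (i : Fin k) → (∃ λ v → c v ≡ i) × StrongInDominating D (λ v → c v ≡ i)

-- d_s^-(D) = m : m is the maximum number of classes of such a partition.
DsIn≡ : ∀ {p} → Digraph p → ℕ → Set
DsIn≡ D m = HasSIDPartition D m × (∀ k → HasSIDPartition D k → k ≤ m)

-- Let T be the first m vertices and s the last one. Take the complete digraph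
-- and delete the arcs between s and the vertices outside T. Every vertex of T
-- is joined both ways to all other vertices, so T splits into m singletons
-- that, after distributing the remaining vertices, give m strong in-dominating
-- classes. Conversely, let x ∉ T, x ≠ s (it exists as p ≥ m + 2). Every strong
-- in-dominating set S contains an out-neighbour of s: if s ∉ S, by domination;
-- if s ∈ S, take the second vertex of a walk in S from s to x, or, if x ∉ S, to
-- an out-neighbour of x in S, which is not s. Out-neighbours of s lie in T, so
-- a partition into k such sets has k ≤ m.
module Submission where

open import Defs
open import Data.Nat using (ℕ; zero; suc; _≤_; _<_; _*_; _+_; z≤n; s≤s; _<?_; s≤s⁻¹)
open import Data.Nat.Properties
  using (≤-trans; <-irrefl; <-asym; <⇒≢; +-monoˡ-≤; +-identityʳ; m<n⇒m≤1+n; m<n⇒m<1+n)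
open import Data.Fin using (Fin; toℕ; fromℕ; fromℕ<; inject≤; _≟_)
import Data.Fin as Fin
open import Data.Fin.Properties
  using (toℕ-injective; toℕ-fromℕ; toℕ-fromℕ<; toℕ-inject≤; toℕ<n; fromℕ<-injective; injective⇒≤)
open import Data.Product using (Σ; ∃; _×_; _,_; proj₂)
open import Data.Sum using (_⊎_; inj₁; inj₂)
open import Data.Unit using (⊤; tt)
open import Data.Empty using (⊥-elim)
open import Relation.Nullary using (¬_; Dec; yes; no; does; proof)
open import Relation.Nullary.Reflects using (Reflects; invert)
open import Relation.Nullary.Decidable using (dec-true; dec-false; ¬?; _×-dec_; _⊎-dec_)
open import Relation.Unary using (Decidable)
open import Function using (_∘_)
open import Relation.Binary.PropositionalEquality using (_≡_; _≢_; refl; sym; trans; cong; subst)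

module _ {p : ℕ} (D : Digraph p) where

  _++ᵂ_ : ∀ {S u v w} → WalkIn D S u v → WalkIn D S v w → WalkIn D S u w
  here _       ++ᵂ q = q
  step s a r ++ᵂ q = step s a (r ++ᵂ q)

  WalkIn-start : ∀ {S u v} → WalkIn D S u v → S u
  WalkIn-start (here s)     = s
  WalkIn-start (step s _ _) = s

  WalkIn⇒outNeighbour : ∀ {S u v} → WalkIn D S u v → u ≢ v → ∃ λ w → S w × Arc D u w
  WalkIn⇒outNeighbour (here _)     u≢u = ⊥-elim (u≢u refl)
  WalkIn⇒outNeighbour (step _ a r) _   = _ , WalkIn-start r , a

  Universal : Fin p → Set
  Universal h = (∀ u → u ≢ h → Arc D u h) × (∀ v → h ≢ v → Arc D h v)

  universal⇒InducedStrong : ∀ {S h} → S h → Universal h → InducedStrong D S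
  universal⇒InducedStrong {S} {h} Sh (into , out) u v Su Sv = toHub ++ᵂ fromHub
    where
      toHub : WalkIn D S u h
      toHub with u ≟ h
      ... | yes refl = here Su
      ... | no u≢h   = step Su (into u u≢h) (here Sh)
      fromHub : WalkIn D S h v
      fromHub with h ≟ v
      ... | yes refl = here Sh
      ... | no h≢v   = step Sh (out v h≢v) (here Sv)

  universal⇒StrongInDominating : ∀ {S h} → S h → Universal h → StrongInDominating D S
  universal⇒StrongInDominating {h = h} Sh U@(into , _) =
    (λ v v∉S → h , Sh , into v λ { refl → v∉S Sh }) , universal⇒InducedStrong Sh U

  universal⇒Strong : ∀ {h} → Universal h → Strong D
  universal⇒Strong U u v = universal⇒InducedStrong tt U u v tt tt

  universalRepresentatives⇒HasSIDPartition :
    ∀ {k} (c : Fin p → Fin k) (r : Fin k → Fin p) →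
    (∀ i → c (r i) ≡ i) → (∀ i → Universal (r i)) → HasSIDPartition D k
  universalRepresentatives⇒HasSIDPartition c r cr≡ U =
    c , λ i → (r i , cr≡ i) , universal⇒StrongInDominating (cr≡ i) (U i)

  StrongInDominating⇒outNeighbour : ∀ {S s x} → Decidable S → x ≢ s → ¬ Arc D x s →
    StrongInDominating D S → ∃ λ w → S w × Arc D s w
  StrongInDominating⇒outNeighbour {s = s} {x} S? x≢s ¬x→s (dominating , strong)
    with S? s | S? x
  ... | no s∉S  | _       = dominating s s∉S
  ... | yes s∈S | yes x∈S = WalkIn⇒outNeighbour (strong s x s∈S x∈S) (x≢s ∘ sym)
  ... | yes s∈S | no x∉S  with dominating x x∉S
  ...   | w , w∈S , x→w = WalkIn⇒outNeighbour (strong s w s∈S w∈S) λ { refl → ¬x→s x→w }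

classesMeetingInitialSegment⇒≤ : ∀ {p k m} (c : Fin p → Fin k) →
  (∀ i → ∃ λ v → c v ≡ i × toℕ v < m) → k ≤ m
classesMeetingInitialSegment⇒≤ {m = m} c meets = injective⇒≤ index-injective
  where
    index : Fin _ → Fin m
    index i with meets i
    ... | _ , _ , v<m = fromℕ< v<m
    index-injective : ∀ {i j} → index i ≡ index j → i ≡ j
    index-injective {i} {j} eq with meets i | meets j
    ... | v , refl , v<m | w , refl , w<m =
      cong c (toℕ-injective (fromℕ<-injective (toℕ v) (toℕ w) v<m w<m eq))

module Construction (m n : ℕ) (0<m : 0 < m) (m<n : m < n) where

  InT : Fin (suc n) → Set
  InT v = toℕ v < m

  s : Fin (suc n)
  s = fromℕ n

  Adjacent : Fin (suc n) → Fin (suc n) → Set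
  Adjacent u v = u ≢ v × (InT u ⊎ InT v ⊎ (u ≢ s × v ≢ s))

  adjacent? : ∀ u v → Dec (Adjacent u v)
  adjacent? u v =
    ¬? (u ≟ v) ×-dec (toℕ u <? m ⊎-dec toℕ v <? m ⊎-dec (¬? (u ≟ s) ×-dec ¬? (v ≟ s)))

  D : Digraph (suc n)
  D = record
    { arc      = λ u v → does (adjacent? u v)
    ; loopless = λ v → dec-false (adjacent? v v) λ (v≢v , _) → v≢v refl
    }

  Arc⇒Adjacent : ∀ {u v} → Arc D u v → Adjacent u v
  Arc⇒Adjacent {u} {v} u→v = invert (subst (Reflects _) u→v (proof (adjacent? u v)))

  s∉T : ¬ InT s
  s∉T s<m = <-asym m<n (subst (_< m) (toℕ-fromℕ n) s<m)

  InT⇒Universal : ∀ {t} → InT t → Universal D t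
  InT⇒Universal {t} t<m =
    (λ u u≢t → dec-true (adjacent? u t) (u≢t , inj₂ (inj₁ t<m))) ,
    (λ v t≢v → dec-true (adjacent? t v) (t≢v , inj₁ t<m))

  outNeighbour-s⇒InT : ∀ {w} → Arc D s w → InT w
  outNeighbour-s⇒InT s→w with Arc⇒Adjacent s→w
  ... | _ , inj₁ s<m               = ⊥-elim (s∉T s<m)
  ... | _ , inj₂ (inj₁ w<m)        = w<m
  ... | _ , inj₂ (inj₂ (s≢s , _)) = ⊥-elim (s≢s refl)

  ¬InT⇒¬Arc-s : ∀ {x} → ¬ InT x → ¬ Arc D x s
  ¬InT⇒¬Arc-s x∉T x→s with Arc⇒Adjacent x→s
  ... | _ , inj₁ x<m               = x∉T x<m
  ... | _ , inj₂ (inj₁ s<m)        = s∉T s<m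
  ... | _ , inj₂ (inj₂ (_ , s≢s)) = s≢s refl

  strong : Strong D
  strong = universal⇒Strong D (InT⇒Universal {Fin.zero} 0<m)

  class : Fin (suc n) → Fin m
  class v with toℕ v <? m
  ... | yes v<m = fromℕ< v<m
  ... | no _    = fromℕ< 0<m

  representative : Fin m → Fin (suc n)
  representative i = inject≤ i (m<n⇒m≤1+n m<n)

  representative∈T : ∀ i → InT (representative i)
  representative∈T i = subst (_< m) (sym (toℕ-inject≤ i _)) (toℕ<n i)

  class-representative : ∀ i → class (representative i) ≡ i
  class-representative i with toℕ (representative i) <? m
  ... | yes r<m = toℕ-injective (trans (toℕ-fromℕ< r<m) (toℕ-inject≤ i _))
  ... | no r∉T  = ⊥-elim (r∉T (representative∈T i))

  partition : HasSIDPartition D m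
  partition = universalRepresentatives⇒HasSIDPartition D class representative
    class-representative (InT⇒Universal ∘ representative∈T)

  x : Fin (suc n)
  x = fromℕ< (m<n⇒m<1+n m<n)

  x∉T : ¬ InT x
  x∉T = <-irrefl (toℕ-fromℕ< _)

  x≢s : x ≢ s
  x≢s x≡s = <⇒≢ m<n (trans (sym (toℕ-fromℕ< _)) (trans (cong toℕ x≡s) (toℕ-fromℕ n)))

  partition⇒≤ : ∀ k → HasSIDPartition D k → k ≤ m
  partition⇒≤ k (c , classes) = classesMeetingInitialSegment⇒≤ c λ i →
    let w , cw≡i , s→w = StrongInDominating⇒outNeighbour D (λ v → c v ≟ i) x≢s
                           (¬InT⇒¬Arc-s x∉T) (proj₂ (classes i))
    in w , cw≡i , outNeighbour-s⇒InT s→w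

  ds≡m : DsIn≡ D m
  ds≡m = partition , partition⇒≤

2+m≤p : ∀ {m p} → 0 < m → 2 * m ≤ p → 3 ≤ p → 2 + m ≤ p
2+m≤p {suc zero}    _ _    3≤p = 3≤p
2+m≤p {m@(suc (suc _))} {p} _ 2m≤p _ =
  ≤-trans (+-monoˡ-≤ m (s≤s (s≤s z≤n))) (subst (λ t → m + t ≤ p) (+-identityʳ m) 2m≤p)

corollary4 : (m p : ℕ) → 0 < m → 2 * m ≤ p → 3 ≤ p →
    Σ (Digraph p) λ D → Strong D × DsIn≡ D m
corollary4 m (suc n) 0<m 2m≤p 3≤p = D , strong , ds≡m
  where open Construction m n 0<m (s≤s⁻¹ (2+m≤p 0<m 2m≤p 3≤p))
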